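{- Let $a,b$ be positive integers such that either $b=a\ge3$ and $a$ is odd, or $b>a\ge2$. Define $(g_{a,b}(n))_{n\in\mathbb{N}}$ by $g_{a,b}(n)=0$ for integers $n<0$, $g_{a,b}(0)=a$, $g_{a,b}(1)=b$, and $g_{a,b}(n)=g_{a,b}(n-g_{a,b}(n-1))+g_{a,b}(n-2)$ for $n>1$. Then for all $n\in\mathbb{N}$, $$g_{a,b}(2n)=a,\qquad g_{a,b}(2n+3)=g_{a,b}(2n+3-a)+g_{a,b}(2n+1).$$ In particular, $$g_{a,b}(2n+1)=\begin{cases}b&\text{if }n<\lfloor a/2\rfloor,\\ b+(n+1-\lfloor a/2\rfloor)a&\text{if }a\text{ is odd and }n\ge\lfloor a/2\rfloor,\\ 2^nb&\text{if }a=2.\end{cases}$$ -}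

module Defs where

open import Data.Nat as ℕ using (ℕ; suc; _∸_; _^_; _%_; _/_)
open import Data.Integer as ℤ using (ℤ; +_; _+_; _-_; _<_; _>_)
open import Data.Product using (_×_)
open import Data.Sum using (_⊎_)
open import Relation.Binary.PropositionalEquality using (_≡_)

Admissible : ℕ → ℕ → Set
Admissible a b = (b ≡ a × 3 ℕ.≤ a × a % 2 ≡ 1) ⊎ (a ℕ.< b × 2 ℕ.≤ a)

IsG : ℕ → ℕ → (ℤ → ℤ) → Set
IsG a b g =
  ((n : ℤ) → n < + 0 → g n ≡ + 0) ×
  (g (+ 0) ≡ + a) ×
  (g (+ 1) ≡ + b) ×
  ((n : ℤ) → n > + 1 → g n ≡ g (n - g (n - + 1)) + g (n - + 2))

{-# OPTIONS --safe #-}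
module Submission where

-- By strong induction on k, any solution satisfies g (2k) = a and g (2k+1) ≥ 2k+3, with
-- g (2k+1) = b while 2k+1 < a. The large odd value makes the look-back index 2k+2 − g (2k+1)
-- negative, so g (2k+2) = 0 + g (2k) = a; at 2k+3 the recurrence then reads
-- g (2k+3) = g (2k+3−a) + g (2k+1), whose first term is either 0 (when 2k+3 < a, and then the
-- hypothesis on (a, b) gives b ≥ 2k+5) or one of the earlier values, all ≥ 2. The closed forms
-- follow from this odd recurrence, since 2n+3−a is even when a is odd and is 2n+1 when a = 2.
-- A solution exists because the recurrence truncated to earlier indices has a positive
-- solution, whose look-back index n − g (n−1) therefore always lies below n.

open import Defs
open import Data.Nat as ℕ using (ℕ; zero; suc; _∸_; _^_; _%_; _/_; z≤n; s≤s; z<s)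
import Data.Nat.Properties as ℕₚ
open import Data.Nat.DivMod using (m≡m%n+[m/n]*n; m/n*n≤m)
open import Data.Nat.Induction using (<-rec; <-wellFounded)
open import Data.Integer as ℤ using (ℤ; +_; -[1+_]; _+_; _-_; _⊖_)
import Data.Integer.Properties as ℤₚ
open import Data.Product using (_×_; _,_; ∃; proj₁; proj₂)
open import Data.Sum using (inj₁; inj₂)
open import Function using (_∘_)
open import Induction.WellFounded using (module FixPoint)
open import Relation.Binary.PropositionalEquality
  using (_≡_; refl; sym; trans; cong; cong₂; subst; subst₂; module ≡-Reasoning)
open import Relation.Nullary using (yes; no; contradiction)

data Parity : ℕ → Set where
  even : ∀ k → Parity (2 ℕ.* k)
  odd  : ∀ k → Parity (suc (2 ℕ.* k))

parity : ∀ n → Parity n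
parity zero = even 0
parity (suc n) with parity n
... | even k = odd k
... | odd k  = subst Parity (ℕₚ.*-suc 2 k) (even (suc k))

2*m≤1+2*n⇒m≤n : ∀ {m n} → 2 ℕ.* m ℕ.≤ suc (2 ℕ.* n) → m ℕ.≤ n
2*m≤1+2*n⇒m≤n {m} {n} p =
  ℕₚ.≤-pred (ℕₚ.*-cancelˡ-< 2 m (suc n) (subst (2 ℕ.* m ℕ.<_) (sym (ℕₚ.*-suc 2 n)) (s≤s p)))

1+2*m<1+2*n⇒3+2*m≤1+2*n : ∀ {m n} → suc (2 ℕ.* m) ℕ.< suc (2 ℕ.* n) → 3 ℕ.+ 2 ℕ.* m ℕ.≤ suc (2 ℕ.* n)
1+2*m<1+2*n⇒3+2*m≤1+2*n {m} {n} (s≤s p) =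
  s≤s (subst (ℕ._≤ 2 ℕ.* n) (ℕₚ.*-suc 2 m) (ℕₚ.*-monoʳ-≤ 2 (ℕₚ.*-cancelˡ-< 2 m n p)))

m<n/2⇒1+2*m<n : ∀ {m n} → m ℕ.< n / 2 → suc (2 ℕ.* m) ℕ.< n
m<n/2⇒1+2*m<n {m} {n} p = begin
  suc (suc (2 ℕ.* m)) ≡⟨ ℕₚ.*-suc 2 m ⟨
  2 ℕ.* suc m         ≤⟨ ℕₚ.*-monoʳ-≤ 2 p ⟩
  2 ℕ.* (n / 2)       ≡⟨ ℕₚ.*-comm 2 (n / 2) ⟩
  n / 2 ℕ.* 2         ≤⟨ m/n*n≤m n 2 ⟩
  n                   ∎
  where open ℕₚ.≤-Reasoning

m%2≡1⇒m≡1+2*[m/2] : ∀ {m} → m % 2 ≡ 1 → m ≡ suc (2 ℕ.* (m / 2))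
m%2≡1⇒m≡1+2*[m/2] {m} m%2≡1 =
  trans (m≡m%n+[m/n]*n m 2) (cong₂ ℕ._+_ m%2≡1 (ℕₚ.*-comm (m / 2) 2))

m<n⇒+m-+n<0 : ∀ {m n} → m ℕ.< n → + m - + n ℤ.< + 0
m<n⇒+m-+n<0 {m} {n} m<n = subst₂ ℤ._<_ (sym (ℤₚ.[+m]-[+n]≡m⊖n m n)) (ℤₚ.n⊖n≡0 m) (ℤₚ.⊖-monoʳ->-< m m<n)

+[m+n]-+m≡+n : ∀ m n → + (m ℕ.+ n) - + m ≡ + n
+[m+n]-+m≡+n m n = begin
  + (m ℕ.+ n) - + m ≡⟨ ℤₚ.[+m]-[+n]≡m⊖n (m ℕ.+ n) m ⟩
  m ℕ.+ n ⊖ m       ≡⟨ ℤₚ.⊖-≥ (ℕₚ.m≤m+n m n) ⟩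
  + (m ℕ.+ n ∸ m)   ≡⟨ cong +_ (ℕₚ.m+n∸m≡n m n) ⟩
  + n               ∎
  where open ≡-Reasoning

module Existence (a b : ℕ) (0<a : 0 ℕ.< a) (0<b : 0 ℕ.< b) where

  History : ℕ → Set
  History n = ∀ {m} → m ℕ.< n → ℕ

  lookup : ∀ {n} → History n → ℤ → ℕ
  lookup {n} h (+ m) with m ℕ.<? n
  ... | yes m<n = h m<n
  ... | no _    = 0
  lookup h -[1+ _ ] = 0

  lookup-ext : ∀ {n} {h h′ : History n} → (∀ {m} (m<n : m ℕ.< n) → h m<n ≡ h′ m<n) →
               ∀ z → lookup h z ≡ lookup h′ z
  lookup-ext {n} h≗h′ (+ m) with m ℕ.<? n
  ... | yes m<n = h≗h′ m<n
  ... | no _    = refl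
  lookup-ext h≗h′ -[1+ _ ] = refl

  -- Out-of-range look-ups return 0; positivity of the solution shows they only ever happen at negative indices.
  step : ∀ n → History n → ℕ
  step zero          h = a
  step (suc zero)    h = b
  step (suc (suc i)) h = lookup h (+ suc (suc i) - + h (ℕₚ.n<1+n (suc i))) ℕ.+ h (ℕₚ.m<n+m i z<s)

  step-ext : ∀ n {h h′ : History n} → (∀ {m} (m<n : m ℕ.< n) → h m<n ≡ h′ m<n) → step n h ≡ step n h′
  step-ext zero          h≗h′ = refl
  step-ext (suc zero)    h≗h′ = refl
  step-ext (suc (suc i)) {h} {h′} h≗h′ =
    cong₂ ℕ._+_ (trans (cong (lookup h ∘ (+ suc (suc i) -_) ∘ +_) (h≗h′ 1+i<2+i))
                       (lookup-ext h≗h′ (+ suc (suc i) - + h′ 1+i<2+i)))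
                (h≗h′ (ℕₚ.m<n+m i z<s))
    where
    1+i<2+i : suc i ℕ.< suc (suc i)
    1+i<2+i = ℕₚ.n<1+n (suc i)

  open FixPoint <-wellFounded (λ _ → ℕ) step step-ext using (unfold-wfRec)

  G : ℕ → ℕ
  G = <-rec (λ _ → ℕ) step

  G-unfold : ∀ n → G n ≡ step n (λ {m} _ → G m)
  G-unfold n = unfold-wfRec {n}

  g : ℤ → ℤ
  g (+ n)    = + G n
  g -[1+ _ ] = + 0

  G-positive : ∀ n → 0 ℕ.< G n
  G-positive zero          rewrite G-unfold 0 = 0<a
  G-positive (suc zero)    rewrite G-unfold 1 = 0<b
  G-positive (suc (suc i)) rewrite G-unfold (suc (suc i)) =
    ℕₚ.≤-trans (G-positive i) (ℕₚ.m≤n+m (G i) _)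

  lookup-G : ∀ {n} z → z ℤ.< + n → + lookup {n} (λ {m} _ → G m) z ≡ g z
  lookup-G {n} (+ m) z<n with m ℕ.<? n
  ... | yes _   = refl
  ... | no m≮n = contradiction (ℤₚ.drop‿+<+ z<n) m≮n
  lookup-G -[1+ _ ] _ = refl

  recurrence : ∀ i → g (+ suc (suc i)) ≡ g (+ suc (suc i) - g (+ suc i)) + g (+ i)
  recurrence i = begin
    + G (suc (suc i))                        ≡⟨ cong +_ (G-unfold (suc (suc i))) ⟩
    + lookup (λ {m} _ → G m) j + + G i        ≡⟨ cong (_+ + G i) (lookup-G j j<2+i) ⟩
    g j + g (+ i)                            ∎
    where
    open ≡-Reasoning
    j : ℤ
    j = + suc (suc i) - + G (suc i)
    j<2+i : j ℤ.< + suc (suc i)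
    j<2+i = subst (ℤ._< + suc (suc i)) (sym (ℤₚ.[+m]-[+n]≡m⊖n (suc (suc i)) (G (suc i))))
                  (ℤₚ.m⊖1+n<m (suc (suc i)) (G (suc i)) {{ℕ.>-nonZero (G-positive (suc i))}})

  solution : ∃ (IsG a b)
  solution = g , (λ { (+ _) (ℤ.+<+ ()) ; -[1+ _ ] _ → refl })
               , cong +_ (G-unfold 0) , cong +_ (G-unfold 1)
               , λ { (+ suc (suc i)) _ → recurrence i
                   ; (+ 0) (ℤ.+<+ ()) ; (+ 1) (ℤ.+<+ (s≤s ())) }

-- b-clears is the only consequence of Admissible the argument uses.
module Shape (a b : ℕ) (2≤a : 2 ℕ.≤ a)
             (b-clears : ∀ k → suc (2 ℕ.* k) ℕ.< a → 3 ℕ.+ 2 ℕ.* k ℕ.≤ b)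
             (g : ℤ → ℤ) (isG : IsG a b g) where

  g<0 : ∀ {m n} → m ℕ.< n → g (+ m - + n) ≡ + 0
  g<0 m<n = proj₁ isG _ (m<n⇒+m-+n<0 m<n)

  g-shift : ∀ {m} n e → n ℕ.+ e ≡ m → g (+ m - + n) ≡ g (+ e)
  g-shift n e refl = cong g (+[m+n]-+m≡+n n e)

  g[0]≡a : g (+ 0) ≡ + a
  g[0]≡a = proj₁ (proj₂ isG)

  g[1]≡b : g (+ 1) ≡ + b
  g[1]≡b = proj₁ (proj₂ (proj₂ isG))

  recurrence : ∀ i → g (+ suc (suc i)) ≡ g (+ suc (suc i) - g (+ suc i)) + g (+ i)
  recurrence i = proj₂ (proj₂ (proj₂ isG)) (+ suc (suc i)) (ℤ.+<+ (s≤s (s≤s z≤n)))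

  record OddTerm (n : ℕ) : Set where
    field
      value         : ℕ
      g≡value       : g (+ n) ≡ + value
      value-large   : 2 ℕ.+ n ℕ.≤ value
      value-initial : n ℕ.< a → value ≡ b

  Pair : ℕ → Set
  Pair n = g (+ n) ≡ + a × OddTerm (suc n)

  Regular : ℕ → Set
  Regular k = Pair (2 ℕ.* k)

  2≤values : ∀ {k} → (∀ {j} → j ℕ.≤ k → Regular j) →
             ∀ x → x ℕ.≤ suc (2 ℕ.* k) → ∃ λ w → g (+ x) ≡ + w × 2 ℕ.≤ w
  2≤values regular x x≤ with parity x
  ... | even j = a , proj₁ (regular {j} (2*m≤1+2*n⇒m≤n x≤)) , 2≤a
  ... | odd j  = value , g≡value , ℕₚ.m+n≤o⇒m≤o 2 value-large
    where open OddTerm (proj₂ (regular {j} (ℕₚ.*-cancelˡ-≤ 2 (ℕ.s≤s⁻¹ x≤))))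

  even-step : ∀ k → Regular k → g (+ suc (suc (2 ℕ.* k))) ≡ + a
  even-step k (g[2k]≡a , t) = begin
    g (+ suc (suc (2 ℕ.* k)))                                ≡⟨ recurrence (2 ℕ.* k) ⟩
    g (+ suc (suc (2 ℕ.* k)) - g (+ suc (2 ℕ.* k))) + g (+ (2 ℕ.* k))
      ≡⟨ cong₂ _+_ (trans (cong (λ v → g (+ suc (suc (2 ℕ.* k)) - v)) g≡value) (g<0 value-large)) g[2k]≡a ⟩
    + a                                                       ∎
    where
    open ≡-Reasoning
    open OddTerm t

  recurrence-at-odd : ∀ k → g (+ suc (suc (2 ℕ.* k))) ≡ + a →
                      g (+ (3 ℕ.+ 2 ℕ.* k)) ≡ g (+ (3 ℕ.+ 2 ℕ.* k) - + a) + g (+ suc (2 ℕ.* k))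
  recurrence-at-odd k g[2+2k]≡a = trans (recurrence (suc (2 ℕ.* k)))
    (cong (λ v → g (+ (3 ℕ.+ 2 ℕ.* k) - v) + g (+ suc (2 ℕ.* k))) g[2+2k]≡a)

  odd-step : ∀ k → (∀ {j} → j ℕ.≤ k → Regular j) → g (+ suc (suc (2 ℕ.* k))) ≡ + a →
             OddTerm (3 ℕ.+ 2 ℕ.* k)
  odd-step k regular g[2+2k]≡a with a ℕ.≤? 3 ℕ.+ 2 ℕ.* k
  ... | yes a≤ with 2≤values regular (3 ℕ.+ 2 ℕ.* k ∸ a) (ℕₚ.∸-monoʳ-≤ (3 ℕ.+ 2 ℕ.* k) 2≤a)
  ...   | w , g≡w , 2≤w = record
    { value         = w ℕ.+ value
    ; g≡value       = trans (recurrence-at-odd k g[2+2k]≡a)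
                            (cong₂ _+_ (trans (g-shift a _ (ℕₚ.m+[n∸m]≡n a≤)) g≡w) g≡value)
    ; value-large   = ℕₚ.+-mono-≤ 2≤w value-large
    ; value-initial = λ 3+2k<a → contradiction a≤ (ℕₚ.<⇒≱ 3+2k<a)
    }
    where open OddTerm (proj₂ (regular {k} ℕₚ.≤-refl))
  odd-step k regular g[2+2k]≡a | no a≰ = record
    { value         = value
    ; g≡value       = trans (recurrence-at-odd k g[2+2k]≡a) (cong₂ _+_ (g<0 (ℕₚ.≰⇒> a≰)) g≡value)
    ; value-large   = subst (5 ℕ.+ 2 ℕ.* k ℕ.≤_) (sym value≡b) (b-clears-3+2k (ℕₚ.≰⇒> a≰))
    ; value-initial = λ _ → value≡b
    }
    where
    open OddTerm (proj₂ (regular {k} ℕₚ.≤-refl))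
    value≡b : value ≡ b
    value≡b = value-initial (ℕₚ.m+n≤o⇒n≤o 2 (ℕₚ.≰⇒> a≰))
    b-clears-3+2k : 3 ℕ.+ 2 ℕ.* k ℕ.< a → 5 ℕ.+ 2 ℕ.* k ℕ.≤ b
    b-clears-3+2k = subst (λ x → suc x ℕ.< a → 3 ℕ.+ x ℕ.≤ b) (ℕₚ.*-suc 2 k) (b-clears (suc k))

  regular : ∀ k → Regular k
  regular = <-rec Regular regular-step
    where
    regular-step : ∀ k → (∀ {j} → j ℕ.< k → Regular j) → Regular k
    regular-step zero _ = g[0]≡a , record
      { value = b ; g≡value = g[1]≡b ; value-large = b-clears 0 2≤a ; value-initial = λ _ → refl }
    regular-step (suc k) regular< = subst Pair (sym (ℕₚ.*-suc 2 k))
      (g[2+2k]≡a , odd-step k (λ {j} j≤k → regular< {j} (s≤s j≤k)) g[2+2k]≡a)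
      where
      g[2+2k]≡a : g (+ suc (suc (2 ℕ.* k))) ≡ + a
      g[2+2k]≡a = even-step k (regular< {k} (ℕₚ.n<1+n k))

  even-value : ∀ n → g (+ (2 ℕ.* n)) ≡ + a
  even-value n = proj₁ (regular n)

  recurrence-3+2n : ∀ n → g (+ (3 ℕ.+ 2 ℕ.* n)) ≡ g (+ (3 ℕ.+ 2 ℕ.* n) - + a) + g (+ suc (2 ℕ.* n))
  recurrence-3+2n n = recurrence-at-odd n (subst (λ m → g (+ m) ≡ + a) (ℕₚ.*-suc 2 n) (even-value (suc n)))

  initial-odd-value : ∀ n → suc (2 ℕ.* n) ℕ.< a → g (+ suc (2 ℕ.* n)) ≡ + b
  initial-odd-value n 1+2n<a = trans g≡value (cong +_ (value-initial 1+2n<a))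
    where open OddTerm (proj₂ (regular n))

  odd-increment : ∀ {c} → a ≡ suc (2 ℕ.* c) → ∀ m e → suc m ≡ c ℕ.+ e →
                  g (+ (3 ℕ.+ 2 ℕ.* m)) ≡ + a + g (+ suc (2 ℕ.* m))
  odd-increment {c} a≡1+2c m e 1+m≡c+e =
    trans (recurrence-3+2n m) (cong (_+ g (+ suc (2 ℕ.* m))) (trans (g-shift a (2 ℕ.* e) a+2e≡3+2m) (even-value e)))
    where
    open ≡-Reasoning
    a+2e≡3+2m : a ℕ.+ 2 ℕ.* e ≡ 3 ℕ.+ 2 ℕ.* m
    a+2e≡3+2m = begin
      a ℕ.+ 2 ℕ.* e               ≡⟨ cong (ℕ._+ 2 ℕ.* e) a≡1+2c ⟩
      suc (2 ℕ.* c ℕ.+ 2 ℕ.* e)   ≡⟨ cong suc (ℕₚ.*-distribˡ-+ 2 c e) ⟨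
      suc (2 ℕ.* (c ℕ.+ e))       ≡⟨ cong (suc ∘ (2 ℕ.*_)) 1+m≡c+e ⟨
      suc (2 ℕ.* suc m)           ≡⟨ cong suc (ℕₚ.*-suc 2 m) ⟩
      3 ℕ.+ 2 ℕ.* m               ∎

  odd-tail : ∀ c → a ≡ suc (2 ℕ.* c) → ∀ d → g (+ suc (2 ℕ.* (c ℕ.+ d))) ≡ + (b ℕ.+ suc d ℕ.* a)
  odd-tail zero    a≡1 _ = contradiction (subst (2 ℕ.≤_) a≡1 2≤a) λ { (s≤s ()) }
  odd-tail (suc c) a≡3+2c zero = begin
    g (+ suc (2 ℕ.* (suc c ℕ.+ 0)))  ≡⟨ cong (λ m → g (+ suc (2 ℕ.* m))) (ℕₚ.+-identityʳ (suc c)) ⟩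
    g (+ suc (2 ℕ.* suc c))          ≡⟨ cong (g ∘ +_ ∘ suc) (ℕₚ.*-suc 2 c) ⟩
    g (+ (3 ℕ.+ 2 ℕ.* c))            ≡⟨ odd-increment {suc c} a≡3+2c c 0 (sym (ℕₚ.+-identityʳ (suc c))) ⟩
    + a + g (+ suc (2 ℕ.* c))         ≡⟨ cong (_+_ (+ a)) (initial-odd-value c 1+2c<a) ⟩
    + (a ℕ.+ b)                       ≡⟨ cong +_ (ℕₚ.+-comm a b) ⟩
    + (b ℕ.+ a)                       ≡⟨ cong (λ x → + (b ℕ.+ x)) (ℕₚ.*-identityˡ a) ⟨
    + (b ℕ.+ 1 ℕ.* a)                 ∎
    where
    open ≡-Reasoning
    1+2c<a : suc (2 ℕ.* c) ℕ.< a
    1+2c<a = subst (suc (2 ℕ.* c) ℕ.<_) (sym a≡3+2c)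
                   (ℕₚ.≤-trans (ℕₚ.≤-reflexive (sym (ℕₚ.*-suc 2 c))) (ℕₚ.n≤1+n _))
  odd-tail (suc c) a≡3+2c (suc d) = begin
    g (+ suc (2 ℕ.* (suc c ℕ.+ suc d)))   ≡⟨ cong (λ m → g (+ suc (2 ℕ.* m))) (ℕₚ.+-suc (suc c) d) ⟩
    g (+ suc (2 ℕ.* suc (suc c ℕ.+ d)))   ≡⟨ cong (g ∘ +_ ∘ suc) (ℕₚ.*-suc 2 (suc c ℕ.+ d)) ⟩
    g (+ (3 ℕ.+ 2 ℕ.* (suc c ℕ.+ d)))
      ≡⟨ odd-increment {suc c} a≡3+2c (suc c ℕ.+ d) (suc d) (sym (ℕₚ.+-suc (suc c) d)) ⟩
    + a + g (+ suc (2 ℕ.* (suc c ℕ.+ d))) ≡⟨ cong (_+_ (+ a)) (odd-tail (suc c) a≡3+2c d) ⟩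
    + (a ℕ.+ (b ℕ.+ suc d ℕ.* a))          ≡⟨ cong +_ (ℕₚ.+-assoc a b _) ⟨
    + (a ℕ.+ b ℕ.+ suc d ℕ.* a)            ≡⟨ cong (λ x → + (x ℕ.+ suc d ℕ.* a)) (ℕₚ.+-comm a b) ⟩
    + (b ℕ.+ a ℕ.+ suc d ℕ.* a)            ≡⟨ cong +_ (ℕₚ.+-assoc b a _) ⟩
    + (b ℕ.+ suc (suc d) ℕ.* a)            ∎
    where open ≡-Reasoning

  powers-of-two : a ≡ 2 → ∀ n → g (+ suc (2 ℕ.* n)) ≡ + (2 ^ n ℕ.* b)
  powers-of-two a≡2 zero = trans g[1]≡b (cong +_ (sym (ℕₚ.*-identityˡ b)))
  powers-of-two a≡2 (suc n) = begin
    g (+ suc (2 ℕ.* suc n))                        ≡⟨ cong (g ∘ +_ ∘ suc) (ℕₚ.*-suc 2 n) ⟩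
    g (+ (3 ℕ.+ 2 ℕ.* n))                          ≡⟨ recurrence-3+2n n ⟩
    g (+ (3 ℕ.+ 2 ℕ.* n) - + a) + g (+ suc (2 ℕ.* n))
      ≡⟨ cong (_+ g (+ suc (2 ℕ.* n))) (g-shift a (suc (2 ℕ.* n)) (cong (ℕ._+ suc (2 ℕ.* n)) a≡2)) ⟩
    g (+ suc (2 ℕ.* n)) + g (+ suc (2 ℕ.* n))      ≡⟨ cong₂ _+_ (powers-of-two a≡2 n) (powers-of-two a≡2 n) ⟩
    + (x ℕ.+ x)                                    ≡⟨ cong (λ y → + (x ℕ.+ y)) (ℕₚ.+-identityʳ x) ⟨
    + (2 ℕ.* x)                                    ≡⟨ cong +_ (ℕₚ.*-assoc 2 (2 ^ n) b) ⟨
    + (2 ^ suc n ℕ.* b)                            ∎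
    where
    open ≡-Reasoning
    x : ℕ
    x = 2 ^ n ℕ.* b

  odd-recurrence : ∀ n → g (+ (2 ℕ.* n ℕ.+ 3)) ≡ g (+ (2 ℕ.* n ℕ.+ 3) - + a) + g (+ (2 ℕ.* n ℕ.+ 1))
  odd-recurrence n rewrite ℕₚ.+-comm (2 ℕ.* n) 3 | ℕₚ.+-comm (2 ℕ.* n) 1 = recurrence-3+2n n

  odd-values-below-half : ∀ n → n ℕ.< a / 2 → g (+ (2 ℕ.* n ℕ.+ 1)) ≡ + b
  odd-values-below-half n n<a/2 rewrite ℕₚ.+-comm (2 ℕ.* n) 1 = initial-odd-value n (m<n/2⇒1+2*m<n n<a/2)

  odd-values-for-odd-a : ∀ n → a % 2 ≡ 1 → a / 2 ℕ.≤ n →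
                         g (+ (2 ℕ.* n ℕ.+ 1)) ≡ + (b ℕ.+ (suc n ∸ a / 2) ℕ.* a)
  odd-values-for-odd-a n a%2≡1 a/2≤n rewrite ℕₚ.+-comm (2 ℕ.* n) 1 = begin
    g (+ suc (2 ℕ.* n))                         ≡⟨ cong (λ m → g (+ suc (2 ℕ.* m))) (ℕₚ.m+[n∸m]≡n a/2≤n) ⟨
    g (+ suc (2 ℕ.* (a / 2 ℕ.+ (n ∸ a / 2))))  ≡⟨ odd-tail (a / 2) (m%2≡1⇒m≡1+2*[m/2] a%2≡1) (n ∸ a / 2) ⟩
    + (b ℕ.+ suc (n ∸ a / 2) ℕ.* a)            ≡⟨ cong (λ x → + (b ℕ.+ x ℕ.* a)) (ℕₚ.+-∸-assoc 1 a/2≤n) ⟨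
    + (b ℕ.+ (suc n ∸ a / 2) ℕ.* a)            ∎
    where open ≡-Reasoning

  odd-values-for-a≡2 : ∀ n → a ≡ 2 → g (+ (2 ℕ.* n ℕ.+ 1)) ≡ + (2 ^ n ℕ.* b)
  odd-values-for-a≡2 n a≡2 rewrite ℕₚ.+-comm (2 ℕ.* n) 1 = powers-of-two a≡2 n

admissible⇒2≤a : ∀ {a b} → Admissible a b → 2 ℕ.≤ a
admissible⇒2≤a (inj₁ (_ , 3≤a , _)) = ℕₚ.≤-trans (ℕₚ.n≤1+n 2) 3≤a
admissible⇒2≤a (inj₂ (_ , 2≤a))     = 2≤a

admissible⇒b-clears : ∀ {a b} → Admissible a b → ∀ k → suc (2 ℕ.* k) ℕ.< a → 3 ℕ.+ 2 ℕ.* k ℕ.≤ b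
admissible⇒b-clears {a} (inj₁ (refl , _ , a%2≡1)) k 1+2k<a =
  subst (3 ℕ.+ 2 ℕ.* k ℕ.≤_) (sym a≡1+2h)
        (1+2*m<1+2*n⇒3+2*m≤1+2*n {k} {a / 2} (subst (suc (2 ℕ.* k) ℕ.<_) a≡1+2h 1+2k<a))
  where
  a≡1+2h : a ≡ suc (2 ℕ.* (a / 2))
  a≡1+2h = m%2≡1⇒m≡1+2*[m/2] a%2≡1
admissible⇒b-clears (inj₂ (a<b , _)) k 1+2k<a = ℕₚ.≤-trans (s≤s 1+2k<a) a<b

theorem6p3 : (a b : ℕ) → Admissible a b →
    ∃ (IsG a b) ×
    ((g : ℤ → ℤ) → IsG a b g → (n : ℕ) →
      (g (+ (2 ℕ.* n)) ≡ + a) ×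
      (g (+ (2 ℕ.* n ℕ.+ 3)) ≡ g (+ (2 ℕ.* n ℕ.+ 3) - + a) + g (+ (2 ℕ.* n ℕ.+ 1))) ×
      (n ℕ.< a / 2 → g (+ (2 ℕ.* n ℕ.+ 1)) ≡ + b) ×
      (a % 2 ≡ 1 → a / 2 ℕ.≤ n → g (+ (2 ℕ.* n ℕ.+ 1)) ≡ + (b ℕ.+ (suc n ∸ a / 2) ℕ.* a)) ×
      (a ≡ 2 → g (+ (2 ℕ.* n ℕ.+ 1)) ≡ + (2 ^ n ℕ.* b)))
theorem6p3 a b adm = Existence.solution a b 0<a 0<b , λ g isG n →
  let open Shape a b 2≤a b-clears g isG in
  even-value n , odd-recurrence n , odd-values-below-half n , odd-values-for-odd-a n , odd-values-for-a≡2 n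
  where
  2≤a : 2 ℕ.≤ a
  2≤a = admissible⇒2≤a adm
  b-clears : ∀ k → suc (2 ℕ.* k) ℕ.< a → 3 ℕ.+ 2 ℕ.* k ℕ.≤ b
  b-clears = admissible⇒b-clears adm
  0<a : 0 ℕ.< a
  0<a = ℕₚ.<-≤-trans z<s 2≤a
  0<b : 0 ℕ.< b
  0<b = ℕₚ.<-≤-trans z<s (b-clears 0 2≤a)
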